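{- Let $G=(V,E)$ be a graph and $\{C_1,\dots,C_k\}$ a generalized $k$-community structure of $G$. Let $i,j\in\{1,\dots,k\}$ with $i\ne j$ and let $v\in V$. If $C_i\subseteq N[v]$ and $C_j\not\subseteq N[v]$, then $v\notin C_j$.
   Context: $N[v]=N(v)\cup\{v\}$ is the closed neighbourhood and $N_C(v)$ the set of neighbours of $v$ in $C$. A generalized $k$-community structure of $G$ is a partition of $V$ into $k\ge 2$ nonempty sets $C_1,\dots,C_k$ such that for all $i$, every $v\in C_i$ and every $j\ne i$: $|N_{C_i}(v)|\cdot|C_j|\ge |N_{C_j}(v)|\cdot(|C_i|-1)$. -}

module Defs where

open import Data.Nat using (ℕ; _*_; _∸_; _≤_)
open import Data.Bool using (Bool; false)
open import Data.Fin using (Fin; _≟_)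
open import Data.Fin.Subset using (Subset; _∩_; _∪_; ⁅_⁆; ∣_∣)
open import Data.Vec using (tabulate)
open import Data.Product using (∃)
open import Relation.Nullary using (does; ¬_)
open import Relation.Binary.PropositionalEquality using (_≡_)

record Graph (n : ℕ) : Set where
  field
    adj   : Fin n → Fin n → Bool
    sym   : ∀ u v → adj u v ≡ adj v u
    irrefl : ∀ v → adj v v ≡ false
open Graph public

N : ∀ {n} → Graph n → Fin n → Subset n
N G v = tabulate (adj G v)

N[_]_ : ∀ {n} → Graph n → Fin n → Subset n
N[ G ] v = N G v ∪ ⁅ v ⁆

-- A partition of Fin n into k labelled classes, given by a class map;
-- the class C j is the set of vertices labelled j.
Class : ∀ {n k} → (Fin n → Fin k) → Fin k → Subset n
Class c j = tabulate (λ u → does (c u ≟ j))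

N-in : ∀ {n} → Graph n → Fin n → Subset n → Subset n
N-in G v C = N G v ∩ C

record IsGenCommunityStructure {n k : ℕ} (G : Graph n) (c : Fin n → Fin k) : Set where
  field
    two≤k    : 2 ≤ k
    nonempty : ∀ j → ∃ λ u → c u ≡ j
    balance  : ∀ i v j → c v ≡ i → ¬ (j ≡ i) →
               ∣ N-in G v (Class c j) ∣ * (∣ Class c i ∣ ∸ 1)
                 ≤ ∣ N-in G v (Class c i) ∣ * ∣ Class c j ∣

-- Suppose v ∈ C_j.  As v ∉ C_i and C_i ⊆ N[v], all of C_i lies in N(v), so the
-- balance inequality at v for the pair (j, i) reads |C_i| (|C_j| − 1) ≤ |N_{C_j}(v)| |C_i|,
-- i.e. v is adjacent to every other vertex of C_j.  A vertex of C_j outside N[v]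
-- makes N_{C_j}(v) a proper subset of C_j − v, a contradiction.
module Submission where

open import Defs hiding (sym)
open import Data.Nat using (ℕ; _*_; _∸_; _≤_; _<_; s≤s; z≤n; >-nonZero)
open import Data.Nat.Properties
  using (≤-trans; ∸-monoˡ-≤; <⇒≱; *-comm; *-monoˡ-≤; *-cancelʳ-≤)
open import Data.Bool using (Bool; true)
open import Data.Fin using (Fin; _≟_)
open import Data.Fin.Subset using (Subset; _⊆_; _⊂_; _∈_; _∉_; _-_; ⁅_⁆; ∣_∣)
open import Data.Fin.Subset.Properties
  using (_∈?_; x∈p∩q⁺; x∈p∩q⁻; x∈p∪q⁺; x∈p∪q⁻; x∈⁅x⁆; x∈⁅y⁆⇒x≡y;
         x∈p∧x≢y⇒x∈p-y; x∈p⇒∣p-x∣<∣p∣; p⊆q⇒∣p∣≤∣q∣; p⊂q⇒∣p∣<∣q∣)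
open import Data.Vec using (tabulate)
open import Data.Vec.Properties using (lookup∘tabulate; lookup⇒[]=; []=⇒lookup)
open import Data.Empty using (⊥-elim)
open import Data.Product using (_,_)
open import Data.Sum using (inj₁; inj₂)
open import Relation.Nullary using (¬_; yes)
open import Relation.Nullary.Decidable using (dec-true; decidable-stable)
open import Relation.Binary.PropositionalEquality using (_≡_; _≢_; sym; trans; subst)

∈-tabulate⁺ : ∀ {n} (f : Fin n → Bool) x → f x ≡ true → x ∈ tabulate f
∈-tabulate⁺ f x fx≡true = lookup⇒[]= x (tabulate f) (trans (lookup∘tabulate f x) fx≡true)

∈-tabulate⁻ : ∀ {n} (f : Fin n → Bool) x → x ∈ tabulate f → f x ≡ true
∈-tabulate⁻ f x x∈ = trans (sym (lookup∘tabulate f x)) ([]=⇒lookup x∈)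

module _ {n k} (c : Fin n → Fin k) where

  ∈-Class⁺ : ∀ {x j} → c x ≡ j → x ∈ Class c j
  ∈-Class⁺ {x} {j} cx≡j = ∈-tabulate⁺ _ x (dec-true (c x ≟ j) cx≡j)

  ∈-Class⁻ : ∀ {x j} → x ∈ Class c j → c x ≡ j
  ∈-Class⁻ {x} {j} x∈ with c x ≟ j | ∈-tabulate⁻ _ x x∈
  ... | yes cx≡j | _ = cx≡j

  ∣Class∣>0 : ∀ {x j} → c x ≡ j → 0 < ∣ Class c j ∣
  ∣Class∣>0 cx≡j = ≤-trans (s≤s z≤n) (x∈p⇒∣p-x∣<∣p∣ (∈-Class⁺ cx≡j))

module _ {n} (G : Graph n) where

  v∉N : ∀ v → v ∉ N G v
  v∉N v v∈ with trans (sym (∈-tabulate⁻ (adj G v) v v∈)) (irrefl G v)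
  ... | ()

  ∈N[v]⇒∈N : ∀ {u v} → u ∈ N[ G ] v → u ≢ v → u ∈ N G v
  ∈N[v]⇒∈N {u} {v} u∈ u≢v with x∈p∪q⁻ (N G v) _ u∈
  ... | inj₁ u∈N = u∈N
  ... | inj₂ u∈⁅v⁆ = ⊥-elim (u≢v (x∈⁅y⁆⇒x≡y v u∈⁅v⁆))

  ⊆N[v]⇒⊆N-in : ∀ {v} {C : Subset n} → v ∉ C → C ⊆ N[ G ] v → C ⊆ N-in G v C
  ⊆N[v]⇒⊆N-in {v} {C} v∉C C⊆N[v] {u} u∈C =
    x∈p∩q⁺ (∈N[v]⇒∈N (C⊆N[v] u∈C) (λ u≡v → v∉C (subst (_∈ C) u≡v u∈C)) , u∈C)

  N-in⊂C-v : ∀ {u v} {C : Subset n} → u ∈ C → u ∉ N[ G ] v → N-in G v C ⊂ C - v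
  N-in⊂C-v {u} {v} {C} u∈C u∉N[v] = N-in⊆C-v , u , u∈C-v , u∉N-in
    where
    N-in⊆C-v : N-in G v C ⊆ C - v
    N-in⊆C-v x∈ with x∈p∩q⁻ (N G v) C x∈
    ... | x∈N , x∈C = x∈p∧x≢y⇒x∈p-y x∈C (λ x≡v → v∉N v (subst (_∈ N G v) x≡v x∈N))
    u∈C-v : u ∈ C - v
    u∈C-v = x∈p∧x≢y⇒x∈p-y u∈C λ u≡v →
      u∉N[v] (x∈p∪q⁺ (inj₂ (subst (λ w → u ∈ ⁅ w ⁆) u≡v (x∈⁅x⁆ u))))
    u∉N-in : u ∉ N-in G v C
    u∉N-in u∈ with x∈p∩q⁻ (N G v) C u∈
    ... | u∈N , _ = u∉N[v] (x∈p∪q⁺ (inj₁ u∈N))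

  ∣N-in∣<∣C∣∸1 : ∀ {u v} {C : Subset n} → v ∈ C → u ∈ C → u ∉ N[ G ] v →
                 ∣ N-in G v C ∣ < ∣ C ∣ ∸ 1
  ∣N-in∣<∣C∣∸1 v∈C u∈C u∉N[v] =
    ∸-monoˡ-≤ 1 (≤-trans (s≤s (p⊂q⇒∣p∣<∣q∣ (N-in⊂C-v u∈C u∉N[v]))) (x∈p⇒∣p-x∣<∣p∣ v∈C))

a≤a′∧a′*d≤m*a⇒d≤m : ∀ {a a′ d m} → 0 < a → a ≤ a′ → a′ * d ≤ m * a → d ≤ m
a≤a′∧a′*d≤m*a⇒d≤m {a} {a′} {d} {m} a>0 a≤a′ a′*d≤m*a =
  *-cancelʳ-≤ d m a {{>-nonZero a>0}}
    (≤-trans (subst (_≤ a′ * d) (*-comm a d) (*-monoˡ-≤ d a≤a′)) a′*d≤m*a)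

module _ {n k} {G : Graph n} {c : Fin n → Fin k} (S : IsGenCommunityStructure G c) where
  open IsGenCommunityStructure S

  ∣Class∣∸1≤∣N-in∣ : ∀ {i j v} → c v ≡ j → i ≢ j → Class c i ⊆ N[ G ] v →
                     ∣ Class c j ∣ ∸ 1 ≤ ∣ N-in G v (Class c j) ∣
  ∣Class∣∸1≤∣N-in∣ {i} {j} {v} cv≡j i≢j Ci⊆N[v] with nonempty i
  ... | w , cw≡i = a≤a′∧a′*d≤m*a⇒d≤m (∣Class∣>0 c cw≡i)
                     (p⊆q⇒∣p∣≤∣q∣ (⊆N[v]⇒⊆N-in G v∉Ci Ci⊆N[v]))
                     (balance j v i cv≡j i≢j)
    where
    v∉Ci : v ∉ Class c i
    v∉Ci v∈Ci = i≢j (trans (sym (∈-Class⁻ c v∈Ci)) cv≡j)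

mainTheorem8 : ∀ {n k : ℕ} (G : Graph n) (c : Fin n → Fin k) →
    IsGenCommunityStructure G c →
    ∀ (i j : Fin k) (v : Fin n) → ¬ (i ≡ j) →
    Class c i ⊆ (N[ G ] v) → ¬ (Class c j ⊆ (N[ G ] v)) →
    v ∉ Class c j
mainTheorem8 G c S i j v i≢j Ci⊆N[v] Cj⊈N[v] v∈Cj = Cj⊈N[v] Cj⊆N[v]
  where
  Cj⊆N[v] : Class c j ⊆ N[ G ] v
  Cj⊆N[v] {u} u∈Cj = decidable-stable (u ∈? N[ G ] v) λ u∉N[v] →
    <⇒≱ (∣N-in∣<∣C∣∸1 G v∈Cj u∈Cj u∉N[v])
        (∣Class∣∸1≤∣N-in∣ S (∈-Class⁻ c v∈Cj) i≢j Ci⊆N[v])
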